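{- Let $n$ be odd and consider $\texttt{GRID}_n$ with sink $s$. Let $\phi$ be the function on its vertices with $\phi(s)=0$, $\phi((1,1))=1$, harmonic at every other vertex. Let $c=((n+1)/2,(n+1)/2)$ be the center. Then $\phi(c)\ge\phi(x)$ for every vertex $x$ of the form $(n,i)$ or $(i,n)$, $1\le i\le n$ (the boundary sides opposite to the corner $(1,1)$).
   Context: $\texttt{GRID}_n$ is the $n\times n$ grid graph on vertices $(i,j)$, $1\le i,j\le n$, with an added sink vertex $s$ joined by one edge to each non-corner boundary vertex and by two edges to each corner vertex; every non-sink vertex has degree 4. A function $\phi$ is harmonic at a vertex $u$ if $\phi(u)$ equals the average of $\phi$ over the edges incident to $u$ (counting multiplicities). Equivalently $\phi(x)$ is the probability that simple random walk from $x$ hits $(1,1)$ before $s$. -}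

module Defs where

open import Data.Nat using (ℕ; zero; suc; _+_; s≤s)
open import Data.Nat.Properties using (m≤m+n)
open import Data.Fin using (Fin; zero; suc; inject₁; fromℕ; fromℕ<)
open import Data.Maybe using (Maybe; just; nothing)
import Data.Maybe as Maybe
open import Data.Integer using (+_)
open import Data.Rational using (ℚ; _*_; _/_) renaming (_+_ to _+ℚ_)
open import Relation.Binary.PropositionalEquality using (_≡_)

-- Vertices of GRID_n: the sink, or a cell (i , j) with 0-based coordinates
-- (paper's (i+1 , j+1)).
data V (n : ℕ) : Set where
  sink : V n
  cell : Fin n → Fin n → V n

incr : ∀ {n} → Fin n → Maybe (Fin n)
incr {suc zero} zero = nothing
incr {suc (suc n)} zero = just (suc zero)
incr {suc (suc n)} (suc i) = Maybe.map suc (incr i)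

decr : ∀ {n} → Fin n → Maybe (Fin n)
decr zero = nothing
decr (suc i) = just (inject₁ i)

-- A step leaving the grid goes to the sink (one sink edge per missing
-- grid neighbour: one for non-corner boundary vertices, two for corners).
toV : ∀ {n} → Maybe (Fin n) → Fin n → V n
toV nothing j = sink
toV (just i) j = cell i j

toV′ : ∀ {n} → Fin n → Maybe (Fin n) → V n
toV′ i nothing = sink
toV′ i (just j) = cell i j

neighbourSum : ∀ {n} → (V n → ℚ) → Fin n → Fin n → ℚ
neighbourSum φ i j =
  φ (toV (incr i) j) +ℚ φ (toV (decr i) j) +ℚ φ (toV′ i (incr j)) +ℚ φ (toV′ i (decr j))

Harmonic : ∀ {n} → (V n → ℚ) → Fin n → Fin n → Set
Harmonic φ i j = φ (cell i j) ≡ (+ 1 / 4) * neighbourSum φ i j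

-- For n = 2k+1: the centre ((n+1)/2 , (n+1)/2), 0-based index k,
-- and the last index n-1 (paper's n).
centreIdx : (k : ℕ) → Fin (suc (k + k))
centreIdx k = fromℕ< (s≤s (m≤m+n k k))

lastIdx : (k : ℕ) → Fin (suc (k + k))
lastIdx k = fromℕ (k + k)

-- Transport φ to a function ψ on ℕ × ℕ (1-based coordinates, zero off the
-- grid). A discrete minimum principle gives 0 ≤ ψ ≤ 1, so ψ is superharmonic
-- on the whole grid and harmonic away from the corner (1,1). If a reflection ρ
-- maps a region S avoiding the corner into the grid, then ψ ∘ ρ − ψ is
-- superharmonic on S; at a neighbour q ∉ S of p ∈ S it is nonnegative if q is
-- off the grid, vanishes if q is on the mirror axis, and is the negative of its
-- value at p if the axis runs between p and q. So the minimum principle yields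
-- ψ ≤ ψ ∘ ρ on S. Reflections in the lines a = c/2 (c > n) and in the
-- diagonals a − b = d carry a point (n , t) of the far side to the centre
-- without decreasing ψ: a diagonal reflection and then an axis reflection if t
-- is below the centre, an axis reflection in each coordinate otherwise.
module Submission where

open import Defs

-- A module of its own so that ℚ's _+_ is not in scope in the statement below,
-- which uses ℕ's.
module GridPotential where

  open import Level using (0ℓ)
  open import Data.Nat as ℕ using (ℕ; zero; suc; pred; _∸_; z≤n; s≤s)
  import Data.Nat.Properties as ℕ
  open import Data.Integer using (+_; +≤+)
  open import Data.Product using (Σ; _×_; _,_; proj₁; proj₂; swap)
  open import Data.Product.Properties using (≡-dec)
  open import Data.Sum using (_⊎_; inj₁; inj₂)
  open import Data.Empty using (⊥-elim)
  open import Data.Fin using (Fin; zero; suc; toℕ; inject₁; fromℕ<)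
  open import Data.Fin.Properties using (toℕ-fromℕ<; toℕ-fromℕ)
  open import Data.Maybe as Maybe using (Maybe; just; nothing)
  open import Data.List using (List; cartesianProduct; upTo; filter)
  open import Data.List.Membership.Propositional using (_∈_)
  open import Data.List.Membership.Propositional.Properties using (∈-cartesianProduct⁺; ∈-upTo⁺; ∈-filter⁺)
  open import Data.List.Relation.Unary.All using (lookup)
  open import Data.List.Relation.Unary.All.Properties using (all-filter)
  import Data.List.Extrema
  open import Data.Rational using (ℚ; 0ℚ; 1ℚ; _+_; _-_; -_; _*_; _/_; _≤_; _<_; *≤*)
  open import Data.Rational.Properties
    using ( _≟_; _≤?_; +-*-commutativeRing; ≤-decTotalOrder; module ≤-Reasoning
          ; ≤-refl; ≤-reflexive; ≤-antisym; <⇒≤; <-trans; ≤-<-trans; <-≤-trans; <-irrefl; ≮⇒≥; ≰⇒>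
          ; +-mono-≤; +-monoʳ-≤; +-mono-<-≤; +-identityʳ; +-inverseʳ; *-identityˡ; neg-antimono-< )
  open import Relation.Binary.Bundles using (DecTotalOrder)
  open import Relation.Binary.PropositionalEquality
  open import Relation.Unary using (Pred; Decidable)
  open import Relation.Nullary using (¬_; Dec; yes; no)
  open import Relation.Nullary.Decidable using (_×-dec_; ¬?; decidable-stable; dec⇒maybe)
  open import Function using (_∘_)
  open import Tactic.RingSolver using (solve-∀)
  open import Tactic.RingSolver.Core.AlmostCommutativeRing using (AlmostCommutativeRing; fromCommutativeRing)

  open Data.List.Extrema (DecTotalOrder.totalOrder ≤-decTotalOrder)
    using (argmin; argmin-all; f[argmin]≤f[⊤]; f[argmin]≤f[xs])

  ℚ-ring : AlmostCommutativeRing 0ℓ 0ℓ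
  ℚ-ring = fromCommutativeRing +-*-commutativeRing (λ x → dec⇒maybe (0ℚ ≟ x))

  p≤q⇒0≤q-p : ∀ {p q} → p ≤ q → 0ℚ ≤ q - p
  p≤q⇒0≤q-p {p} {q} p≤q = subst (_≤ q - p) (+-inverseʳ p) (+-mono-≤ p≤q (≤-refl { - p}))

  0≤q-p⇒p≤q : ∀ {p q} → 0ℚ ≤ q - p → p ≤ q
  0≤q-p⇒p≤q {p} {q} 0≤q-p = subst₂ _≤_ (+-identityʳ p) (p+[q-p]≡q p q) (+-monoʳ-≤ p 0≤q-p)
    where
      p+[q-p]≡q : ∀ p q → p + (q - p) ≡ q
      p+[q-p]≡q = solve-∀ ℚ-ring

  neg⇒<-neg : ∀ {x} → x < 0ℚ → x < - x
  neg⇒<-neg x<0 = <-trans x<0 (neg-antimono-< x<0)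

  0≤1 : 0ℚ ≤ 1ℚ
  0≤1 = *≤* (+≤+ z≤n)

  +-swap-first : ∀ x y z w → x + y + z + w ≡ y + x + z + w
  +-swap-first = solve-∀ ℚ-ring

  +-swap-pairs : ∀ x y z w → x + y + z + w ≡ z + w + x + y
  +-swap-pairs = solve-∀ ℚ-ring

  m∸n≡1+[m∸1+n] : ∀ {m n} → n ℕ.< m → m ∸ n ≡ suc (m ∸ suc n)
  m∸n≡1+[m∸1+n] {suc m} {zero}  _         = refl
  m∸n≡1+[m∸1+n] {suc m} {suc n} (s≤s n<m) = m∸n≡1+[m∸1+n] n<m

  Point : Set
  Point = ℕ × ℕ

  up down right left : Point → Point
  up    (a , b) = suc a , b
  down  (a , b) = pred a , b
  right (a , b) = a , suc b
  left  (a , b) = a , pred b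

  data _~_ (p : Point) : Point → Set where
    ~up    : p ~ up p
    ~down  : p ~ down p
    ~right : p ~ right p
    ~left  : p ~ left p

  4× : ℚ → ℚ
  4× x = x + x + x + x

  adjacentSum : (Point → ℚ) → Point → ℚ
  adjacentSum f p = f (up p) + f (down p) + f (right p) + f (left p)

  4×x<y₁+y₂+y₃+y₄ : ∀ {x y₁ y₂ y₃ y₄} → x < y₁ → x ≤ y₂ → x ≤ y₃ → x ≤ y₄ → 4× x < y₁ + y₂ + y₃ + y₄
  4×x<y₁+y₂+y₃+y₄ x<y₁ x≤y₂ x≤y₃ x≤y₄ = +-mono-<-≤ (+-mono-<-≤ (+-mono-<-≤ x<y₁ x≤y₂) x≤y₃) x≤y₄

  superharmonic-minus-harmonic : ∀ {f g p} → adjacentSum f p ≤ 4× (f p) → 4× (g p) ≡ adjacentSum g p →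
    adjacentSum (λ q → f q - g q) p ≤ 4× (f p - g p)
  superharmonic-minus-harmonic {f} {g} {p} f-super g-harm =
    subst₂ _≤_ (sym (adjacentSum-distrib (f (up p)) (f (down p)) (f (right p)) (f (left p))
                                         (g (up p)) (g (down p)) (g (right p)) (g (left p))))
               (trans (cong (λ s → 4× (f p) - s) (sym g-harm)) (sym (4×-distrib (f p) (g p))))
               (+-mono-≤ f-super (≤-refl { - adjacentSum g p}))
    where
      adjacentSum-distrib : ∀ x₁ x₂ x₃ x₄ y₁ y₂ y₃ y₄ →
        (x₁ - y₁) + (x₂ - y₂) + (x₃ - y₃) + (x₄ - y₄) ≡ (x₁ + x₂ + x₃ + x₄) - (y₁ + y₂ + y₃ + y₄)
      adjacentSum-distrib = solve-∀ ℚ-ring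
      -- 4× spelled out: the ring solver does not unfold definitions.
      4×-distrib : ∀ x y → (x - y) + (x - y) + (x - y) + (x - y) ≡ (x + x + x + x) - (y + y + y + y)
      4×-distrib = solve-∀ ℚ-ring

  InRange : ℕ → ℕ → Set
  InRange n a = 1 ℕ.≤ a × a ℕ.≤ n

  inRange? : ∀ n a → Dec (InRange n a)
  inRange? n a = (1 ℕ.≤? a) ×-dec (a ℕ.≤? n)

  InGrid : ℕ → Point → Set
  InGrid n (a , b) = InRange n a × InRange n b

  inGrid? : ∀ n → Decidable (InGrid n)
  inGrid? n (a , b) = inRange? n a ×-dec inRange? n b

  gridPoints : ℕ → List Point
  gridPoints n = cartesianProduct (upTo (suc n)) (upTo (suc n))

  ∈-gridPoints : ∀ {n p} → InGrid n p → p ∈ gridPoints n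
  ∈-gridPoints ((_ , a≤n) , (_ , b≤n)) = ∈-cartesianProduct⁺ (∈-upTo⁺ (s≤s a≤n)) (∈-upTo⁺ (s≤s b≤n))

  module MinimumPrinciple {n : ℕ} {S : Pred Point 0ℓ} (S? : Decidable S) (S⊆grid : ∀ {p} → S p → InGrid n p)
    (D : Point → ℚ) (superharmonic : ∀ {p} → S p → adjacentSum D p ≤ 4× (D p))
    (exit : ∀ {p q} → S p → p ~ q → ¬ S q → D p < 0ℚ → D p < D q) where

    -- A negative minimum of D on S is also attained at the upper neighbour of
    -- every point attaining it, so it climbs out of the bounded set S.
    private module _ (m : ℚ) (m<0 : m < 0ℚ) (m-min : ∀ {q} → S q → m ≤ D q) where

      m<exit : ∀ {p q} → S p → D p ≡ m → p ~ q → ¬ S q → m < D q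
      m<exit {q = q} Sp Dp≡m p~q ¬Sq = subst (_< D q) Dp≡m (exit Sp p~q ¬Sq (subst (_< 0ℚ) (sym Dp≡m) m<0))

      m≤neighbour : ∀ {p q} → S p → D p ≡ m → p ~ q → m ≤ D q
      m≤neighbour {q = q} Sp Dp≡m p~q with S? q
      ... | yes Sq = m-min Sq
      ... | no ¬Sq = <⇒≤ (m<exit Sp Dp≡m p~q ¬Sq)

      up-not-above : ∀ {p} → S p → D p ≡ m → ¬ (m < D (up p))
      up-not-above Sp Dp≡m m<up = <-irrefl refl (<-≤-trans
        (subst (λ x → 4× x < adjacentSum D _) (sym Dp≡m)
          (4×x<y₁+y₂+y₃+y₄ m<up (m≤neighbour Sp Dp≡m ~down) (m≤neighbour Sp Dp≡m ~right) (m≤neighbour Sp Dp≡m ~left)))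
        (superharmonic Sp))

      up-attains-minimum : ∀ {p} → S p → D p ≡ m → S (up p) × D (up p) ≡ m
      up-attains-minimum {p} Sp Dp≡m with S? (up p)
      ... | no ¬Sup = ⊥-elim (up-not-above Sp Dp≡m (m<exit Sp Dp≡m ~up ¬Sup))
      ... | yes Sup = Sup , ≤-antisym (≮⇒≥ (up-not-above Sp Dp≡m)) (m-min Sup)

      climb : ∀ j {a b} → S (a , b) → D (a , b) ≡ m → ¬ (n ℕ.< j ℕ.+ a)
      climb zero    Sp _ n<a = ℕ.<⇒≱ n<a (proj₂ (proj₁ (S⊆grid Sp)))
      climb (suc j) {a} Sp Dp≡m n<1+j+a with up-attains-minimum Sp Dp≡m
      ... | Sup , Dup≡m = climb j Sup Dup≡m (subst (n ℕ.<_) (sym (ℕ.+-suc j a)) n<1+j+a)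

    minimum-principle : ∀ {p} → S p → 0ℚ ≤ D p
    minimum-principle {p} Sp with 0ℚ ≤? D p
    ... | yes 0≤Dp = 0≤Dp
    ... | no 0≰Dp = ⊥-elim (climb (D z) Dz<0 z-min (suc n) Sz refl (ℕ.m≤m+n (suc n) (proj₁ z)))
      where
        candidates : List Point
        candidates = filter S? (gridPoints n)
        z : Point
        z = argmin D p candidates
        Sz : S z
        Sz = argmin-all D Sp (all-filter S? (gridPoints n))
        Dz<0 : D z < 0ℚ
        Dz<0 = ≤-<-trans (f[argmin]≤f[⊤] {f = D} p candidates) (≰⇒> 0≰Dp)
        z-min : ∀ {q} → S q → D z ≤ D q
        z-min Sq = lookup (f[argmin]≤f[xs] {f = D} p candidates) (∈-filter⁺ S? (∈-gridPoints (S⊆grid Sq)) Sq)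

  -- Where the Dirichlet problem imposes harmonicity: all other points carry
  -- boundary values, 1 at the corner and 0 off the grid (the sink).
  Interior : ℕ → Point → Set
  Interior n p = InGrid n p × p ≢ (1 , 1)

  interior? : ∀ n → Decidable (Interior n)
  interior? n p = inGrid? n p ×-dec ¬? (≡-dec ℕ._≟_ ℕ._≟_ p (1 , 1))

  record IsCornerPotential (n : ℕ) (ψ : Point → ℚ) : Set where
    field
      vanishes : ∀ {p} → ¬ InGrid n p → ψ p ≡ 0ℚ
      corner   : ψ (1 , 1) ≡ 1ℚ
      harmonic : ∀ {p} → Interior n p → 4× (ψ p) ≡ adjacentSum ψ p

  transpose : ∀ {n ψ} → IsCornerPotential n ψ → IsCornerPotential n (ψ ∘ swap)
  transpose {n} {ψ} P = record
    { vanishes = λ ¬g → vanishes (¬g ∘ swap)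
    ; corner   = corner
    ; harmonic = λ { {a , b} ((ga , gb) , p≢11) →
        trans (harmonic ((gb , ga) , p≢11 ∘ cong swap))
              (+-swap-pairs (ψ (suc b , a)) (ψ (pred b , a)) (ψ (b , suc a)) (ψ (b , pred a))) }
    }
    where open IsCornerPotential P

  module CornerPotential {n : ℕ} {ψ : Point → ℚ} (P : IsCornerPotential n ψ) where
    open IsCornerPotential P

    off-interior : ∀ {p} → ¬ Interior n p → ¬ InGrid n p ⊎ p ≡ (1 , 1)
    off-interior {p} ¬int with inGrid? n p
    ... | no ¬g = inj₁ ¬g
    ... | yes g = inj₂ (decidable-stable (≡-dec ℕ._≟_ ℕ._≟_ p (1 , 1)) (λ p≢11 → ¬int (g , p≢11)))

    boundary-values : ∀ {p} → ¬ Interior n p → 0ℚ ≤ ψ p × ψ p ≤ 1ℚ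
    boundary-values ¬int with off-interior ¬int
    ... | inj₁ ¬g   rewrite vanishes ¬g = ≤-refl , 0≤1
    ... | inj₂ refl rewrite corner      = 0≤1 , ≤-refl

    nonnegative : ∀ p → 0ℚ ≤ ψ p
    nonnegative p with interior? n p
    ... | no ¬int = proj₁ (boundary-values ¬int)
    ... | yes int = minimum-principle int
      where
        open MinimumPrinciple (interior? n) proj₁ ψ (λ int → ≤-reflexive (sym (harmonic int)))
          (λ _ _ ¬int ψp<0 → <-≤-trans ψp<0 (proj₁ (boundary-values ¬int)))

    ≤1 : ∀ p → ψ p ≤ 1ℚ
    ≤1 p with interior? n p
    ... | no ¬int = proj₂ (boundary-values ¬int)
    ... | yes int = 0≤q-p⇒p≤q (minimum-principle int)
      where
        open MinimumPrinciple (interior? n) proj₁ (λ q → 1ℚ - ψ q)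
          (λ int → superharmonic-minus-harmonic {f = λ _ → 1ℚ} {g = ψ} ≤-refl (harmonic int))
          (λ _ _ ¬int Dp<0 → <-≤-trans Dp<0 (p≤q⇒0≤q-p (proj₂ (boundary-values ¬int))))

    superharmonic : ∀ {p} → InGrid n p → adjacentSum ψ p ≤ 4× (ψ p)
    superharmonic {p} g with ≡-dec ℕ._≟_ ℕ._≟_ p (1 , 1)
    ... | no p≢11   = ≤-reflexive (sym (harmonic (g , p≢11)))
    ... | yes refl rewrite corner = +-mono-≤ (+-mono-≤ (+-mono-≤ (≤1 _) (≤1 _)) (≤1 _)) (≤1 _)

    module Reflection {S : Pred Point 0ℓ} (S? : Decidable S) (S⊆interior : ∀ {p} → S p → Interior n p)
      (ρ : Point → Point) (ρ-grid : ∀ {p} → S p → InGrid n (ρ p))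
      (ρ-adjacent : ∀ {p} → S p → adjacentSum (ψ ∘ ρ) p ≡ adjacentSum ψ (ρ p))
      (ρ-exit : ∀ {p q} → S p → p ~ q → ¬ S q → InGrid n q → ρ q ≡ q ⊎ (ρ q ≡ p × ρ p ≡ q)) where

      private
        gain : Point → ℚ
        gain p = ψ (ρ p) - ψ p

        gain-exit : ∀ {p q} → S p → p ~ q → ¬ S q → gain p < 0ℚ → gain p < gain q
        gain-exit {p} {q} Sp p~q ¬Sq gain<0 with inGrid? n q
        ... | no ¬g rewrite vanishes ¬g = <-≤-trans gain<0 (subst (0ℚ ≤_) (sym (+-identityʳ _)) (nonnegative (ρ q)))
        ... | yes g with ρ-exit Sp p~q ¬Sq g
        ...   | inj₁ ρq≡q = <-≤-trans gain<0 (≤-reflexive (sym (trans (cong (λ r → ψ r - ψ q) ρq≡q) (+-inverseʳ (ψ q)))))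
        ...   | inj₂ (ρq≡p , ρp≡q) = subst (gain p <_) -gain[p]≡gain[q] (neg⇒<-neg gain<0)
          where
            -[x-y]≡y-x : ∀ x y → - (x - y) ≡ y - x
            -[x-y]≡y-x = solve-∀ ℚ-ring
            -gain[p]≡gain[q] : - gain p ≡ gain q
            -gain[p]≡gain[q] = begin
              - (ψ (ρ p) - ψ p)  ≡⟨ cong (λ r → - (ψ r - ψ p)) ρp≡q ⟩
              - (ψ q - ψ p)      ≡⟨ -[x-y]≡y-x (ψ q) (ψ p) ⟩
              ψ p - ψ q          ≡⟨ cong (λ r → ψ r - ψ q) ρq≡p ⟨
              ψ (ρ q) - ψ q      ∎
              where open ≡-Reasoning

      reflection-principle : ∀ {p} → S p → ψ p ≤ ψ (ρ p)
      reflection-principle Sp = 0≤q-p⇒p≤q (minimum-principle Sp)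
        where
          open MinimumPrinciple S? (proj₁ ∘ S⊆interior) gain
            (λ {p} Sp → superharmonic-minus-harmonic {f = ψ ∘ ρ} {g = ψ}
               (subst (_≤ 4× (ψ (ρ p))) (sym (ρ-adjacent Sp)) (superharmonic (ρ-grid Sp))) (harmonic (S⊆interior Sp)))
            gain-exit

    module AxisReflection (c : ℕ) (n<c : n ℕ.< c) where

      Beyond : Point → Set
      Beyond (a , b) = InGrid n (a , b) × c ℕ.< a ℕ.+ a

      beyond? : Decidable Beyond
      beyond? (a , b) = inGrid? n (a , b) ×-dec (c ℕ.<? a ℕ.+ a)

      ρ : Point → Point
      ρ (a , b) = c ∸ a , b

      a<c : ∀ {a b} → Beyond (a , b) → a ℕ.< c
      a<c (((_ , a≤n) , _) , _) = ℕ.≤-<-trans a≤n n<c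

      beyond⇒interior : ∀ {p} → Beyond p → Interior n p
      beyond⇒interior (g@((_ , 1≤n) , _) , c<2) =
        g , λ { refl → ℕ.<-irrefl refl (ℕ.<-≤-trans c<2 (ℕ.≤-trans (s≤s 1≤n) n<c)) }

      ρ-grid : ∀ {p} → Beyond p → InGrid n (ρ p)
      ρ-grid {suc a , b} B@(((_ , a≤n) , gb) , c<a+a) =
        (ℕ.m<n⇒0<n∸m (a<c B) , ℕ.≤-trans (ℕ.<⇒≤ (ℕ.m<n+o⇒m∸n<o c (suc a) c<a+a)) a≤n) , gb

      ρ-adjacent : ∀ {p} → Beyond p → adjacentSum (ψ ∘ ρ) p ≡ adjacentSum ψ (ρ p)
      ρ-adjacent {suc a , b} B =
        trans (cong₂ (λ x y → ψ (x , b) + ψ (y , b) + ψ (c ∸ suc a , suc b) + ψ (c ∸ suc a , pred b))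
                     (sym (ℕ.pred[m∸n]≡m∸[1+n] c (suc a))) (m∸n≡1+[m∸1+n] (ℕ.<⇒≤ (a<c B))))
              (+-swap-first (ψ (pred (c ∸ suc a) , b)) (ψ (suc (c ∸ suc a) , b))
                            (ψ (c ∸ suc a , suc b)) (ψ (c ∸ suc a , pred b)))

      ρ-exit : ∀ {p q} → Beyond p → p ~ q → ¬ Beyond q → InGrid n q → ρ q ≡ q ⊎ (ρ q ≡ p × ρ p ≡ q)
      ρ-exit {a , _} (_ , c<a+a) ~up ¬Bq gq =
        ⊥-elim (¬Bq (gq , ℕ.<-≤-trans c<a+a (ℕ.+-mono-≤ (ℕ.n≤1+n a) (ℕ.n≤1+n a))))
      ρ-exit (_ , c<a+a) ~right ¬Bq gq = ⊥-elim (¬Bq (gq , c<a+a))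
      ρ-exit (_ , c<a+a) ~left  ¬Bq gq = ⊥-elim (¬Bq (gq , c<a+a))
      ρ-exit {suc a , b} (_ , c<2+2a) ~down ¬Bq gq with ℕ.m≤n⇒m<n∨m≡n c≤1+2a
        where
          c≤1+2a : c ℕ.≤ suc (a ℕ.+ a)
          c≤1+2a = ℕ.≤-pred (subst (c ℕ.<_) (cong suc (ℕ.+-suc a a)) c<2+2a)
      ... | inj₁ c≤2a = inj₁ (cong (_, b) (trans (cong (_∸ a) c≡2a) (ℕ.m+n∸m≡n a a)))
        where
          c≡2a : c ≡ a ℕ.+ a
          c≡2a = ℕ.≤-antisym (ℕ.≤-pred c≤2a) (ℕ.≮⇒≥ (λ c<2a → ¬Bq (gq , c<2a)))
      ... | inj₂ refl = inj₂ (cong (_, b) (ℕ.m+n∸n≡m (suc a) a) , cong (_, b) (ℕ.m+n∸m≡n a a))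

      open Reflection beyond? beyond⇒interior ρ ρ-grid ρ-adjacent ρ-exit public

    axis-reflection-≤ : ∀ {a a' b} → InGrid n (a , b) → a' ℕ.≤ a → n ℕ.< a ℕ.+ a' → ψ (a , b) ≤ ψ (a' , b)
    axis-reflection-≤ {a} {a'} {b} g a'≤a n<a+a' with ℕ.m≤n⇒m<n∨m≡n a'≤a
    ... | inj₂ refl = ≤-refl
    ... | inj₁ a'<a =
      subst (λ x → ψ (a , b) ≤ ψ (x , b)) (ℕ.m+n∸m≡n a a') (reflection-principle (g , ℕ.+-monoʳ-< a a'<a))
      where open AxisReflection (a ℕ.+ a') n<a+a'

    module DiagonalReflection (d : ℕ) where

      Below : Point → Set
      Below (a , b) = InGrid n (a , b) × d ℕ.+ b ℕ.< a

      below? : Decidable Below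
      below? (a , b) = inGrid? n (a , b) ×-dec (d ℕ.+ b ℕ.<? a)

      ρ : Point → Point
      ρ (a , b) = b ℕ.+ d , a ∸ d

      d<a : ∀ {a b} → Below (a , b) → d ℕ.< a
      d<a {a} {b} (_ , d+b<a) = ℕ.≤-<-trans (ℕ.m≤m+n d b) d+b<a

      below⇒interior : ∀ {p} → Below p → Interior n p
      below⇒interior (g , d+1<1) = g , λ { refl → ℕ.<-irrefl refl (ℕ.≤-<-trans (ℕ.m≤n+m 1 d) d+1<1) }

      ρ-grid : ∀ {p} → Below p → InGrid n (ρ p)
      ρ-grid {a , b} B@(((_ , a≤n) , (1≤b , _)) , d+b<a) =
        (ℕ.≤-trans 1≤b (ℕ.m≤m+n b d) , ℕ.≤-trans (ℕ.<⇒≤ (subst (ℕ._< a) (ℕ.+-comm d b) d+b<a)) a≤n) ,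
        (ℕ.m<n⇒0<n∸m (d<a B) , ℕ.≤-trans (ℕ.m∸n≤m a d) a≤n)

      ρ-fixed : ∀ {a b} → d ℕ.+ b ≡ a → ρ (a , b) ≡ (a , b)
      ρ-fixed {a} {b} d+b≡a =
        cong₂ _,_ (trans (ℕ.+-comm b d) d+b≡a) (trans (cong (_∸ d) (sym d+b≡a)) (ℕ.m+n∸m≡n d b))

      ρ-adjacent : ∀ {p} → Below p → adjacentSum (ψ ∘ ρ) p ≡ adjacentSum ψ (ρ p)
      ρ-adjacent {suc a , suc b} B =
        trans (cong₂ (λ x y → ψ (suc b ℕ.+ d , x) + ψ (suc b ℕ.+ d , y)
                              + ψ (suc (suc b) ℕ.+ d , suc a ∸ d) + ψ (b ℕ.+ d , suc a ∸ d))
                     (ℕ.+-∸-assoc 1 (ℕ.<⇒≤ (d<a B))) (sym (ℕ.pred[m∸n]≡m∸[1+n] (suc a) d)))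
              (+-swap-pairs (ψ (suc b ℕ.+ d , suc (suc a ∸ d))) (ψ (suc b ℕ.+ d , pred (suc a ∸ d)))
                            (ψ (suc (suc b ℕ.+ d) , suc a ∸ d)) (ψ (b ℕ.+ d , suc a ∸ d)))

      ρ-exit : ∀ {p q} → Below p → p ~ q → ¬ Below q → InGrid n q → ρ q ≡ q ⊎ (ρ q ≡ p × ρ p ≡ q)
      ρ-exit (_ , d+b<a) ~up ¬Bq gq = ⊥-elim (¬Bq (gq , ℕ.m<n⇒m<1+n d+b<a))
      ρ-exit {a , b} (_ , d+b<a) ~left ¬Bq gq =
        ⊥-elim (¬Bq (gq , ℕ.≤-<-trans (ℕ.+-monoʳ-≤ d (ℕ.pred[n]≤n {b})) d+b<a))
      ρ-exit {a , b} (_ , d+b<a) ~right ¬Bq gq = inj₁ (ρ-fixed (ℕ.≤-antisym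
        (subst (ℕ._≤ a) (sym (ℕ.+-suc d b)) d+b<a) (ℕ.≮⇒≥ (λ d+1+b<a → ¬Bq (gq , d+1+b<a)))))
      ρ-exit {suc a , b} (_ , d+b<1+a) ~down ¬Bq gq = inj₁ (ρ-fixed (ℕ.≤-antisym
        (ℕ.≤-pred d+b<1+a) (ℕ.≮⇒≥ (λ d+b<a → ¬Bq (gq , d+b<a)))))

      open Reflection below? below⇒interior ρ ρ-grid ρ-adjacent ρ-exit public

    diagonal-reflection-≤ : ∀ d {a b} → InGrid n (a , b) → d ℕ.+ b ℕ.< a → ψ (a , b) ≤ ψ (b ℕ.+ d , a ∸ d)
    diagonal-reflection-≤ d g d+b<a = reflection-principle (g , d+b<a)
      where open DiagonalReflection d

  module _ (k : ℕ) {ψ : Point → ℚ} (P : IsCornerPotential (suc (k ℕ.+ k)) ψ) where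
    open CornerPotential P
    open ≤-Reasoning

    private
      n : ℕ
      n = suc (k ℕ.+ k)

      range : ∀ {t} → t ℕ.≤ k ℕ.+ k → InRange n (suc t)
      range t≤2k = s≤s z≤n , s≤s t≤2k

      n<a+[1+k] : ∀ {a} → suc k ℕ.≤ a → n ℕ.< a ℕ.+ suc k
      n<a+[1+k] 1+k≤a = ℕ.<-≤-trans (s≤s (ℕ.+-monoʳ-< k (ℕ.n<1+n k))) (ℕ.+-monoˡ-≤ (suc k) 1+k≤a)

    far-side-≤-centre : ∀ {t} → t ℕ.≤ k ℕ.+ k → ψ (n , suc t) ≤ ψ (suc k , suc k)
    far-side-≤-centre {t} t≤2k with t ℕ.<? k
    ... | yes t<k = begin
      ψ (n , suc t)               ≤⟨ diagonal-reflection-≤ k (range ℕ.≤-refl , range t≤2k) k+1+t<n ⟩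
      ψ (suc t ℕ.+ k , n ∸ k)     ≡⟨ cong (λ x → ψ (suc t ℕ.+ k , x)) (ℕ.m+n∸n≡m (suc k) k) ⟩
      ψ (suc t ℕ.+ k , suc k)     ≤⟨ axis-reflection-≤ (range t+k≤2k , range (ℕ.m≤m+n k k)) 1+k≤1+t+k
                                                       (n<a+[1+k] 1+k≤1+t+k) ⟩
      ψ (suc k , suc k)           ∎
      where
        k+1+t<n : k ℕ.+ suc t ℕ.< n
        k+1+t<n = subst (ℕ._< n) (sym (ℕ.+-suc k t)) (s≤s (ℕ.+-monoʳ-< k t<k))
        t+k≤2k : t ℕ.+ k ℕ.≤ k ℕ.+ k
        t+k≤2k = ℕ.+-monoˡ-≤ k (ℕ.<⇒≤ t<k)
        1+k≤1+t+k : suc k ℕ.≤ suc t ℕ.+ k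
        1+k≤1+t+k = s≤s (ℕ.m≤n+m k t)
    ... | no t≮k = begin
      ψ (n , suc t)        ≤⟨ axis-reflection-≤ (range ℕ.≤-refl , range t≤2k) 1+k≤n (n<a+[1+k] 1+k≤n) ⟩
      ψ (suc k , suc t)    ≤⟨ CornerPotential.axis-reflection-≤ (transpose P) (range t≤2k , range (ℕ.m≤m+n k k))
                                                                1+k≤1+t (n<a+[1+k] 1+k≤1+t) ⟩
      ψ (suc k , suc k)    ∎
      where
        1+k≤n : suc k ℕ.≤ n
        1+k≤n = s≤s (ℕ.m≤m+n k k)
        1+k≤1+t : suc k ℕ.≤ suc t
        1+k≤1+t = s≤s (ℕ.≮⇒≥ t≮k)

  fromℕ? : ∀ {N} → ℕ → Maybe (Fin N)
  fromℕ? {zero}  _       = nothing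
  fromℕ? {suc N} zero    = just zero
  fromℕ? {suc N} (suc a) = Maybe.map suc (fromℕ? a)

  fromℕ?-toℕ : ∀ {N} (i : Fin N) → fromℕ? (toℕ i) ≡ just i
  fromℕ?-toℕ zero    = refl
  fromℕ?-toℕ (suc i) = cong (Maybe.map suc) (fromℕ?-toℕ i)

  fromℕ?-toℕ-inject₁ : ∀ {N} (i : Fin N) → fromℕ? (toℕ i) ≡ just (inject₁ i)
  fromℕ?-toℕ-inject₁ zero    = refl
  fromℕ?-toℕ-inject₁ (suc i) = cong (Maybe.map suc) (fromℕ?-toℕ-inject₁ i)

  fromℕ?-≥ : ∀ {N a} → N ℕ.≤ a → fromℕ? {N} a ≡ nothing
  fromℕ?-≥ {zero}  _         = refl
  fromℕ?-≥ {suc N} (s≤s N≤a) = cong (Maybe.map suc) (fromℕ?-≥ N≤a)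

  -- Grid coordinates are 1-based on Point, as in the paper, but 0-based in Fin.
  coordinate : ∀ {N} → ℕ → Maybe (Fin N)
  coordinate zero    = nothing
  coordinate (suc a) = fromℕ? a

  coordinate-outside : ∀ {N a} → ¬ InRange N a → coordinate {N} a ≡ nothing
  coordinate-outside {a = zero}  _       = refl
  coordinate-outside {N} {suc a} ¬range = fromℕ?-≥ (ℕ.≮⇒≥ (λ a<N → ¬range (s≤s z≤n , a<N)))

  incr≡coordinate : ∀ {N} (i : Fin N) → incr i ≡ coordinate (suc (suc (toℕ i)))
  incr≡coordinate {suc zero}    zero    = refl
  incr≡coordinate {suc (suc N)} zero    = refl
  incr≡coordinate {suc (suc N)} (suc i) = cong (Maybe.map suc) (incr≡coordinate i)

  decr≡coordinate : ∀ {N} (i : Fin N) → decr i ≡ coordinate (toℕ i)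
  decr≡coordinate zero    = refl
  decr≡coordinate (suc i) = sym (fromℕ?-toℕ-inject₁ i)

  toℕ-lastIdx : ∀ k → toℕ (lastIdx k) ≡ k ℕ.+ k
  toℕ-lastIdx k = toℕ-fromℕ (k ℕ.+ k)

  toℕ-centreIdx : ∀ k → toℕ (centreIdx k) ≡ k
  toℕ-centreIdx k = toℕ-fromℕ< (s≤s (ℕ.m≤m+n k k))

  vertexAt : ∀ {N} → Maybe (Fin N) → Maybe (Fin N) → V N
  vertexAt (just i) (just j) = cell i j
  vertexAt _        _        = sink

  vertex : ∀ {N} → Point → V N
  vertex (a , b) = vertexAt (coordinate a) (coordinate b)

  vertexAt-nothingʳ : ∀ {N} (x : Maybe (Fin N)) → vertexAt x nothing ≡ sink
  vertexAt-nothingʳ nothing  = refl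
  vertexAt-nothingʳ (just _) = refl

  inRange⇒toℕ : ∀ {N a} → InRange N a → Σ (Fin N) λ i → suc (toℕ i) ≡ a
  inRange⇒toℕ {a = suc a} (_ , a<N) = fromℕ< a<N , cong suc (toℕ-fromℕ< a<N)

  potential : ∀ {N} → (V N → ℚ) → Point → ℚ
  potential φ = φ ∘ vertex

  cellPoint : ∀ {N} → Fin N → Fin N → Point
  cellPoint i j = suc (toℕ i) , suc (toℕ j)

  toV≡vertexAt : ∀ {N} (x : Maybe (Fin N)) j → toV x j ≡ vertexAt x (just j)
  toV≡vertexAt nothing  _ = refl
  toV≡vertexAt (just _) _ = refl

  toV′≡vertexAt : ∀ {N} i (y : Maybe (Fin N)) → toV′ i y ≡ vertexAt (just i) y
  toV′≡vertexAt _ nothing  = refl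
  toV′≡vertexAt _ (just _) = refl

  vertex-up : ∀ {N} (i j : Fin N) → toV (incr i) j ≡ vertex (up (cellPoint i j))
  vertex-up i j = trans (toV≡vertexAt (incr i) j) (cong₂ vertexAt (incr≡coordinate i) (sym (fromℕ?-toℕ j)))

  vertex-down : ∀ {N} (i j : Fin N) → toV (decr i) j ≡ vertex (down (cellPoint i j))
  vertex-down i j = trans (toV≡vertexAt (decr i) j) (cong₂ vertexAt (decr≡coordinate i) (sym (fromℕ?-toℕ j)))

  vertex-right : ∀ {N} (i j : Fin N) → toV′ i (incr j) ≡ vertex (right (cellPoint i j))
  vertex-right i j = trans (toV′≡vertexAt i (incr j)) (cong₂ vertexAt (sym (fromℕ?-toℕ i)) (incr≡coordinate j))

  vertex-left : ∀ {N} (i j : Fin N) → toV′ i (decr j) ≡ vertex (left (cellPoint i j))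
  vertex-left i j = trans (toV′≡vertexAt i (decr j)) (cong₂ vertexAt (sym (fromℕ?-toℕ i)) (decr≡coordinate j))

  module _ {N : ℕ} (φ : V N → ℚ) where

    potential-cell : ∀ {i j a b} → toℕ i ≡ a → toℕ j ≡ b → potential φ (suc a , suc b) ≡ φ (cell i j)
    potential-cell {i} {j} refl refl = cong φ (cong₂ vertexAt (fromℕ?-toℕ i) (fromℕ?-toℕ j))

    neighbourSum≡adjacentSum : ∀ i j → neighbourSum φ i j ≡ adjacentSum (potential φ) (cellPoint i j)
    neighbourSum≡adjacentSum i j =
      cong₂ _+_ (cong₂ _+_ (cong₂ _+_ (cong φ (vertex-up i j)) (cong φ (vertex-down i j)))
                           (cong φ (vertex-right i j)))
                (cong φ (vertex-left i j))

    harmonic-at-cell : ∀ i j → Harmonic φ i j →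
      4× (potential φ (cellPoint i j)) ≡ adjacentSum (potential φ) (cellPoint i j)
    harmonic-at-cell i j φ-harm = begin
      4× (potential φ (cellPoint i j))        ≡⟨ cong 4× (trans (potential-cell refl refl) φ-harm) ⟩
      4× (¼ * neighbourSum φ i j)             ≡⟨ 4×[¼*x]≡x (neighbourSum φ i j) ⟩
      neighbourSum φ i j                      ≡⟨ neighbourSum≡adjacentSum i j ⟩
      adjacentSum (potential φ) (cellPoint i j) ∎
      where
        open ≡-Reasoning
        ¼ : ℚ
        ¼ = + 1 / 4
        c*x+c*x+c*x+c*x≡[c+c+c+c]*x : ∀ c x → c * x + c * x + c * x + c * x ≡ (c + c + c + c) * x
        c*x+c*x+c*x+c*x≡[c+c+c+c]*x = solve-∀ ℚ-ring
        4×[¼*x]≡x : ∀ x → 4× (¼ * x) ≡ x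
        4×[¼*x]≡x x = trans (c*x+c*x+c*x+c*x≡[c+c+c+c]*x ¼ x) (*-identityˡ x)

  isCornerPotential : ∀ {M} (φ : V (suc M) → ℚ) → φ sink ≡ 0ℚ → φ (cell zero zero) ≡ 1ℚ →
    (∀ i j → ¬ (i ≡ zero × j ≡ zero) → Harmonic φ i j) → IsCornerPotential (suc M) (potential φ)
  isCornerPotential {M} φ φ-sink φ-corner φ-harmonic = record
    { vanishes = vanishes
    ; corner   = φ-corner
    ; harmonic = harmonic
    }
    where
      vanishes : ∀ {p} → ¬ InGrid (suc M) p → potential φ p ≡ 0ℚ
      vanishes {a , b} ¬g with inRange? (suc M) a
      ... | no ¬ra rewrite coordinate-outside ¬ra = φ-sink
      ... | yes ra rewrite coordinate-outside (λ rb → ¬g (ra , rb)) = trans (cong φ (vertexAt-nothingʳ _)) φ-sink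

      harmonic : ∀ {p} → Interior (suc M) p → 4× (potential φ p) ≡ adjacentSum (potential φ) p
      harmonic {a , b} ((ra , rb) , p≢11) with inRange⇒toℕ ra | inRange⇒toℕ rb
      ... | i , refl | j , refl = harmonic-at-cell φ i j (φ-harmonic i j λ (i≡0 , j≡0) →
            p≢11 (cong₂ _,_ (cong (suc ∘ toℕ) i≡0) (cong (suc ∘ toℕ) j≡0)))

open GridPotential

open import Data.Nat using (ℕ; suc; _+_)
open import Data.Fin using (Fin; zero)
open import Data.Product using (_×_)
open import Data.Rational using (ℚ; 0ℚ; 1ℚ; _≤_)
open import Relation.Binary.PropositionalEquality using (_≡_)
open import Relation.Nullary using (¬_)

open import Data.Nat.Properties using (≤-pred)
open import Data.Fin using (toℕ)
open import Data.Fin.Properties using (toℕ<n)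
open import Data.Product using (_,_)
open import Relation.Binary.PropositionalEquality using (refl; subst₂)

lemma15 : (k : ℕ) → (φ : V (suc (k + k)) → ℚ) →
    φ sink ≡ 0ℚ → φ (cell zero zero) ≡ 1ℚ →
    (∀ i j → ¬ (i ≡ zero × j ≡ zero) → Harmonic φ i j) →
    ∀ i → (φ (cell (lastIdx k) i) ≤ φ (cell (centreIdx k) (centreIdx k)))
        × (φ (cell i (lastIdx k)) ≤ φ (cell (centreIdx k) (centreIdx k)))
lemma15 k φ φ-sink φ-corner φ-harmonic i =
  subst₂ _≤_ (potential-cell φ (toℕ-lastIdx k) refl) centre (far-side-≤-centre k P (≤-pred (toℕ<n i))) ,
  subst₂ _≤_ (potential-cell φ refl (toℕ-lastIdx k)) centre (far-side-≤-centre k (transpose P) (≤-pred (toℕ<n i)))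
  where
    P : IsCornerPotential (suc (k + k)) (potential φ)
    P = isCornerPotential φ φ-sink φ-corner φ-harmonic
    centre : potential φ (suc k , suc k) ≡ φ (cell (centreIdx k) (centreIdx k))
    centre = potential-cell φ (toℕ-centreIdx k) (toℕ-centreIdx k)
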